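{- Let $G$ be an undirected graph (loops allowed) that generates a fusion ring. Then for any two vertices $i,j$ of $G$ that both have self-loops, the distance $d(i,j)$ in $G$ is at most $2$.
   Context: A fusion ring of rank $r$ (commutative) is a commutative unital ring, free as a $\mathbb{Z}$-module on a basis $X_0=1,X_1,\dots,X_{r-1}$, with $X_iX_j=\sum_k N_{ij}^kX_k$, $N_{ij}^k\in\mathbb{Z}_{\ge0}$, and an involution $i\mapsto i^*$ with $N_{ij}^0=\delta_{i,j^*}$ and $N_{ij}^k=N_{jk^*}^{i^*}=N_{j^*i^*}^{k^*}$. It is self-dual if $i^*=i$ for all $i$, multiplicity-free if all $N_{ij}^k\in\{0,1\}$. For such a ring the associated digraph $D$ on $\{1,\dots,r-1\}$ has a loop at $i$ iff $N_{ii}^i=1$ and, for $i\ne j$, an arc $(i,j)$ iff $N_{ii}^j=1$; the associated $3$-uniform hypergraph $H$ has hyperedge $\{i,j,k\}$ (distinct) iff $N_{ij}^k=1$. A digraph generates a fusion ring if it is the associated digraph of some self-dual multiplicity-free fusion ring. An undirected graph (possibly with loops) is identified with the digraph having arcs $(i,j),(j,i)$ for each edge $\{i,j\}$, $i\ne j$. The distance $d(i,j)$ is the length of a shortest path (infinite if none). -}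

module Defs where

open import Data.Nat using (ℕ; zero; suc; _+_; _*_; _≤_)
open import Data.Fin using (Fin; zero; suc)
open import Data.Bool using (Bool; true; false; T)
open import Data.Product using (Σ; ∃; _×_; _,_)
open import Relation.Binary.PropositionalEquality using (_≡_; _≢_)
open import Relation.Nullary using (¬_)

∑ : ∀ {r} → (Fin r → ℕ) → ℕ
∑ {zero}  f = 0
∑ {suc r} f = f zero + ∑ (λ i → f (suc i))

δ : ∀ {r} → Fin r → Fin r → ℕ
δ zero    zero    = 1
δ zero    (suc _) = 0
δ (suc _) zero    = 0
δ (suc i) (suc j) = δ i j

-- A commutative fusion ring of rank r = suc n, given by its structure constants
-- N i j k = N_{ij}^k w.r.t. the basis X_0 = 1, X_1, …, X_{r-1}
-- (index zero : Fin r is X_0), together with the involution i ↦ i*.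
record FusionRing (n : ℕ) : Set where
  field
    N     : Fin (suc n) → Fin (suc n) → Fin (suc n) → ℕ
    dual  : Fin (suc n) → Fin (suc n)
    unitˡ : ∀ j k → N zero j k ≡ δ j k
    comm  : ∀ i j k → N i j k ≡ N j i k
    assoc : ∀ i j k l →
            ∑ (λ m → N i j m * N m k l) ≡ ∑ (λ m → N j k m * N i m l)
    dual-invol : ∀ i → dual (dual i) ≡ i
    dual-unit  : ∀ i j → N i j zero ≡ δ i (dual j)
    frob₁ : ∀ i j k → N i j k ≡ N j (dual k) (dual i)
    frob₂ : ∀ i j k → N i j k ≡ N (dual j) (dual i) (dual k)

SelfDual : ∀ {r} → FusionRing r → Set
SelfDual R = ∀ i → FusionRing.dual R i ≡ i

MultiplicityFree : ∀ {r} → FusionRing r → Set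
MultiplicityFree R = ∀ i j k → FusionRing.N R i j k ≤ 1

record Graph (n : ℕ) : Set where
  field
    Adj  : Fin n → Fin n → Bool
    sym  : ∀ i j → Adj i j ≡ Adj j i

-- Associated digraph of a fusion ring of rank suc n, on vertices
-- {1,…,n} ≅ Fin n (vertex i corresponds to basis element suc i):
--   loop at i  iff N_ii^i = 1;  arc (i,j), i ≠ j, iff N_ii^j = 1.
DigraphArc : ∀ {n} → FusionRing n → Fin n → Fin n → Set
DigraphArc R i j = FusionRing.N R (suc i) (suc i) (suc j) ≡ 1

GraphArc : ∀ {n} → Graph n → Fin n → Fin n → Set
GraphArc G i j = T (Graph.Adj G i j)

Generates : ∀ {n} → Graph n → Set
Generates {n} G =
  Σ (FusionRing n) λ R →
    SelfDual R × MultiplicityFree R ×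
    (∀ i j → (DigraphArc R i j → GraphArc G i j) × (GraphArc G i j → DigraphArc R i j))

HasLoop : ∀ {n} → Graph n → Fin n → Set
HasLoop G i = T (Graph.Adj G i i)

data Walk {n} (G : Graph n) : Fin n → Fin n → ℕ → Set where
  []  : ∀ {i} → Walk G i i 0
  _∷_ : ∀ {i j k ℓ} → T (Graph.Adj G i j) → Walk G j k ℓ → Walk G i k (suc ℓ)

DistLE : ∀ {n} → Graph n → Fin n → Fin n → ℕ → Set
DistLE G i j m = Σ ℕ λ ℓ → (ℓ ≤ m) × Walk G i j ℓ

-- Write a = X_{i+1}, b = X_{j+1} with N_aa^a = N_bb^b = 1 and a ≠ b. By associativity
-- ⟨a²,b²⟩ = ⟨ab,ab⟩, and ⟨a²,b²⟩ ≥ 1 from the common constituent X_0. If a² and b²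
-- share a further constituent k, then k is a common neighbour of a and b. Otherwise
-- ⟨ab,ab⟩ = 1, so ab = c is a single basis element, c ≠ X_0 because a ≠ b* = b.
-- The loop at a gives c = ab ≤ a²b = ac, i.e. N_ac^c = N_cc^a = 1, likewise N_cc^b = 1,
-- so c is a common neighbour.
module Submission where

open import Defs
open import Data.Nat using (ℕ; zero; suc; _+_; _*_; _≤_; z≤n)
open import Data.Nat.Properties
  using (≤-trans; ≤-antisym; ≤-refl; ≤-reflexive; m≤m+n; m≤n+m; +-identityʳ; *-mono-≤;
         n≤0⇒n≡0; n≤1⇒n≡0∨n≡1; m*n≡1⇒m≡1; m*n≡1⇒n≡1; suc-injective)
import Data.Nat.Properties as ℕ
open import Data.Fin using (Fin; zero; suc; _≟_)
open import Data.Fin.Properties using (any?)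
import Data.Fin.Properties as Fin
open import Data.Bool using (T)
open import Data.Product using (∃; _×_; _,_; proj₁; proj₂)
open import Data.Sum using (_⊎_; inj₁; inj₂)
open import Function using (_∘_)
open import Relation.Binary.PropositionalEquality
open import Relation.Nullary using (yes; no; contradiction)

∑-cong : ∀ {r} {f g : Fin r → ℕ} → (∀ m → f m ≡ g m) → ∑ f ≡ ∑ g
∑-cong {zero}  f≗g = refl
∑-cong {suc r} f≗g = cong₂ _+_ (f≗g zero) (∑-cong (f≗g ∘ suc))

∑-zero : ∀ {r} (f : Fin r → ℕ) → (∀ m → f m ≡ 0) → ∑ f ≡ 0
∑-zero {zero}  f f≗0 = refl
∑-zero {suc r} f f≗0 rewrite f≗0 zero = ∑-zero (f ∘ suc) (f≗0 ∘ suc)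

∑-supported-at : ∀ {r} (f : Fin r → ℕ) c → (∀ m → m ≢ c → f m ≡ 0) → ∑ f ≡ f c
∑-supported-at {suc r} f zero    f≗0 rewrite ∑-zero (f ∘ suc) (λ m → f≗0 (suc m) λ ()) =
  +-identityʳ (f zero)
∑-supported-at {suc r} f (suc c) f≗0 rewrite f≗0 zero (λ ()) =
  ∑-supported-at (f ∘ suc) c (λ m m≢c → f≗0 (suc m) (m≢c ∘ Fin.suc-injective))

term≤∑ : ∀ {r} (f : Fin r → ℕ) m → f m ≤ ∑ f
term≤∑ f zero    = m≤m+n _ _
term≤∑ f (suc m) = ≤-trans (term≤∑ (f ∘ suc) m) (m≤n+m _ _)

∑≡0⇒≡0 : ∀ {r} (f : Fin r → ℕ) → ∑ f ≡ 0 → ∀ m → f m ≡ 0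
∑≡0⇒≡0 f ∑≡0 m = n≤0⇒n≡0 (≤-trans (term≤∑ f m) (≤-reflexive ∑≡0))

∑≡1⇒support : ∀ {r} (f : Fin r → ℕ) → ∑ f ≡ 1 →
              ∃ λ c → f c ≡ 1 × (∀ m → m ≢ c → f m ≡ 0)
∑≡1⇒support {suc r} f ∑≡1 with f zero in f0
... | zero with ∑≡1⇒support (f ∘ suc) ∑≡1
...   | c , fc≡1 , f≗0 = suc c , fc≡1 , λ { zero _ → f0 ; (suc m) m≢c → f≗0 m (m≢c ∘ cong suc) }
∑≡1⇒support {suc r} f ∑≡1 | suc zero =
  zero , f0 , λ { zero 0≢0 → contradiction refl 0≢0
                ; (suc m) _ → ∑≡0⇒≡0 (f ∘ suc) (suc-injective ∑≡1) m }

δ-refl : ∀ {r} (i : Fin r) → δ i i ≡ 1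
δ-refl zero    = refl
δ-refl (suc i) = δ-refl i

δ≡1⇒≡ : ∀ {r} (i j : Fin r) → δ i j ≡ 1 → i ≡ j
δ≡1⇒≡ zero    zero    _ = refl
δ≡1⇒≡ (suc i) (suc j) e = cong suc (δ≡1⇒≡ i j e)

≤1⇒*-idem : ∀ {x} → x ≤ 1 → x * x ≡ x
≤1⇒*-idem x≤1 with n≤1⇒n≡0∨n≡1 x≤1
... | inj₁ refl = refl
... | inj₂ refl = refl

≤1∧≢1⇒≡0 : ∀ {x} → x ≤ 1 → x ≢ 1 → x ≡ 0
≤1∧≢1⇒≡0 x≤1 x≢1 with n≤1⇒n≡0∨n≡1 x≤1
... | inj₁ x≡0 = x≡0
... | inj₂ x≡1 = contradiction x≡1 x≢1

module SelfDualMultiplicityFree {n} (R : FusionRing n) (sd : SelfDual R)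
                                 (mf : MultiplicityFree R) where
  open FusionRing R

  N-rotate : ∀ i j k → N i j k ≡ N j k i
  N-rotate i j k = trans (frob₁ i j k) (cong₂ (N j) (sd k) (sd i))

  N-swapʳ : ∀ i j k → N i j k ≡ N i k j
  N-swapʳ i j k = trans (comm i j k) (N-rotate j i k)

  N-square-unit : ∀ a → N a a zero ≡ 1
  N-square-unit a = trans (dual-unit a a) (trans (cong (δ a) (sd a)) (δ-refl a))

  N-unit⇒≡ : ∀ a b → N a b zero ≡ 1 → a ≡ b
  N-unit⇒≡ a b e = δ≡1⇒≡ a b (trans (sym (trans (dual-unit a b) (cong (δ a) (sd b)))) e)

  ProductIs : Fin (suc n) → Fin (suc n) → Fin (suc n) → Set
  ProductIs a b c = N a b c ≡ 1 × (∀ m → m ≢ c → N a b m ≡ 0)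

  loop-absorbs-product : ∀ a b c → N a a a ≡ 1 → ProductIs a b c → N a c c ≡ 1
  loop-absorbs-product a b c aaa≡1 (abc≡1 , ab≗0) = ≤-antisym (mf a c c) (begin
    1                                   ≡⟨ sym (cong₂ _*_ aaa≡1 abc≡1) ⟩
    N a a a * N a b c                   ≤⟨ term≤∑ (λ m → N a a m * N m b c) a ⟩
    ∑ (λ m → N a a m * N m b c)         ≡⟨ assoc a a b c ⟩
    ∑ (λ m → N a b m * N a m c)         ≡⟨ ∑-supported-at _ c (λ m m≢c → cong (_* N a m c) (ab≗0 m m≢c)) ⟩
    N a b c * N a c c                   ≡⟨ cong (_* N a c c) abc≡1 ⟩
    N a c c + 0                         ≡⟨ +-identityʳ _ ⟩
    N a c c                             ∎)
    where open ℕ.≤-Reasoning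

  -- The terms of ⟨a², b²⟩ = Σ_m N_aa^m N_bb^m, written via N_bb^m = N_mb^b.
  squareOverlap : Fin (suc n) → Fin (suc n) → Fin (suc n) → ℕ
  squareOverlap a b m = N a a m * N m b b

  ∑-squareOverlap≡∑-product : ∀ a b → ∑ (squareOverlap a b) ≡ ∑ (N a b)
  ∑-squareOverlap≡∑-product a b = begin
    ∑ (λ m → N a a m * N m b b)   ≡⟨ assoc a a b b ⟩
    ∑ (λ m → N a b m * N a m b)   ≡⟨ ∑-cong (λ m → cong (N a b m *_) (N-swapʳ a m b)) ⟩
    ∑ (λ m → N a b m * N a b m)   ≡⟨ ∑-cong (λ m → ≤1⇒*-idem (mf a b m)) ⟩
    ∑ (N a b)                     ∎
    where open ≡-Reasoning

  squareOverlap-unit : ∀ a b → squareOverlap a b zero ≡ 1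
  squareOverlap-unit a b = cong₂ _*_ (N-square-unit a) (trans (unitˡ b b) (δ-refl b))

  squareOverlap≤1 : ∀ a b m → squareOverlap a b m ≤ 1
  squareOverlap≤1 a b m = *-mono-≤ (mf a a m) (mf m b b)

  Adjacent : Fin n → Fin n → Set
  Adjacent x y = N (suc x) (suc x) (suc y) ≡ 1 ⊎ N (suc y) (suc y) (suc x) ≡ 1

  overlap⇒common-neighbour : ∀ i j k → squareOverlap (suc i) (suc j) (suc k) ≡ 1 →
                             Adjacent i k × Adjacent k j
  overlap⇒common-neighbour i j k overlap≡1 =
    inj₁ (m*n≡1⇒m≡1 _ _ overlap≡1) ,
    inj₂ (trans (sym (N-rotate (suc k) (suc j) (suc j)))
                (m*n≡1⇒n≡1 (N (suc i) (suc i) (suc k)) _ overlap≡1))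

  unit-overlap⇒∑-product≡1 : ∀ a b → (∀ m → m ≢ zero → squareOverlap a b m ≢ 1) →
                             ∑ (N a b) ≡ 1
  unit-overlap⇒∑-product≡1 a b no-overlap = begin
    ∑ (N a b)                  ≡⟨ sym (∑-squareOverlap≡∑-product a b) ⟩
    ∑ (squareOverlap a b)      ≡⟨ ∑-supported-at _ zero overlap≡0 ⟩
    squareOverlap a b zero     ≡⟨ squareOverlap-unit a b ⟩
    1                          ∎
    where
    open ≡-Reasoning
    overlap≡0 : ∀ m → m ≢ zero → squareOverlap a b m ≡ 0
    overlap≡0 m m≢0 = ≤1∧≢1⇒≡0 (squareOverlap≤1 a b m) (no-overlap m m≢0)

  product⇒common-neighbour : ∀ i j k →
    N (suc i) (suc i) (suc i) ≡ 1 → N (suc j) (suc j) (suc j) ≡ 1 →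
    ProductIs (suc i) (suc j) (suc k) → Adjacent i k × Adjacent k j
  product⇒common-neighbour i j k loop-a loop-b ab-product@(abc≡1 , ab≗0) =
    inj₂ (trans (sym (N-rotate a c c)) (loop-absorbs-product a b c loop-a ab-product)) ,
    inj₁ (trans (sym (N-rotate b c c)) (loop-absorbs-product b a c loop-b ba-product))
    where
    a = suc i; b = suc j; c = suc k
    ba-product : ProductIs b a c
    ba-product = trans (comm b a c) abc≡1 , λ m m≢c → trans (comm b a m) (ab≗0 m m≢c)

  looped-common-neighbour : ∀ i j → i ≢ j →
    N (suc i) (suc i) (suc i) ≡ 1 → N (suc j) (suc j) (suc j) ≡ 1 →
    ∃ λ k → Adjacent i k × Adjacent k j
  looped-common-neighbour i j i≢j loop-a loop-b
    with any? (λ k → squareOverlap (suc i) (suc j) (suc k) ℕ.≟ 1)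
  ... | yes (k , overlap≡1) = k , overlap⇒common-neighbour i j k overlap≡1
  ... | no no-overlap
    with ∑≡1⇒support (N (suc i) (suc j)) (unit-overlap⇒∑-product≡1 (suc i) (suc j)
           λ { zero 0≢0 → contradiction refl 0≢0 ; (suc k) _ overlap≡1 → no-overlap (k , overlap≡1) })
  ...   | zero  , ij0≡1 , _ = contradiction (Fin.suc-injective (N-unit⇒≡ _ _ ij0≡1)) i≢j
  ...   | suc k , product   = k , product⇒common-neighbour i j k loop-a loop-b product

mainTheorem9 : ∀ {n : ℕ} (G : Graph n) → Generates G →
    ∀ (i j : Fin n) → HasLoop G i → HasLoop G j → DistLE G i j 2
mainTheorem9 G (R , sd , mf , arcs) i j loop-i loop-j with i ≟ j
... | yes refl = 0 , z≤n , []
... | no i≢j =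
  walk (looped-common-neighbour i j i≢j (proj₂ (arcs i i) loop-i) (proj₂ (arcs j j) loop-j))
  where
  open SelfDualMultiplicityFree R sd mf
  edge : ∀ {x y} → Adjacent x y → T (Graph.Adj G x y)
  edge {x} {y} (inj₁ arc) = proj₁ (arcs x y) arc
  edge {x} {y} (inj₂ arc) = subst T (Graph.sym G y x) (proj₁ (arcs y x) arc)
  walk : (∃ λ k → Adjacent i k × Adjacent k j) → DistLE G i j 2
  walk (k , i~k , k~j) = 2 , ≤-refl , (edge i~k ∷ (edge k~j ∷ []))
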